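{- Let $G$ be a graph and $u,v\in V(G)$ such that (1) $u$ and $v$ are joined by at least two internally disjoint paths $P_1,P_2$ (each with endpoints $u$ and $v$) whose internal vertices have degree $2$ in $G$, and (2) $d(u,v)+2<|V(P_1)|$ and $d(u,v)+2<|V(P_2)|$. Let $W\subseteq V(G)$ be such that $(W\setminus\{u,v\})\cap (V(P_1)\cup V(P_2))=\emptyset$. Then $W$ is not a resolving set of $G$.
   Context: Graphs are simple, connected, finite; $d$ denotes shortest-path distance. A set $W\subseteq V(G)$ is resolving if for any distinct $x,y$ there is $w\in W$ with $d(x,w)\ne d(y,w)$. -}

module Defs where

open import Data.Nat using (ℕ; zero; suc; _≤_; _<_; _+_)
open import Data.Fin using (Fin)
open import Data.Bool using (Bool; true; false)
open import Data.Vec using (tabulate)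
open import Data.List using (List; []; _∷_; _++_; [_]; length)
open import Data.List.Relation.Unary.Linked using (Linked)
open import Data.List.Relation.Unary.Unique.Propositional using (Unique)
open import Data.List.Membership.Propositional using () renaming (_∈_ to _∈ₗ_)
open import Data.List.Relation.Unary.All using (All)
open import Data.Fin.Subset using (Subset; _∈_; ∣_∣)
open import Data.Product using (Σ; ∃; _×_; _,_)
open import Relation.Binary.PropositionalEquality using (_≡_; _≢_)
open import Relation.Nullary using (¬_)

record Graph (n : ℕ) : Set where
  field
    adj   : Fin n → Fin n → Bool
    sym   : ∀ x y → adj x y ≡ adj y x
    irrefl : ∀ x → adj x x ≡ false
open Graph public

data Walk {n : ℕ} (G : Graph n) : Fin n → Fin n → ℕ → Set where
  nil  : ∀ {x} → Walk G x x 0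
  cons : ∀ {x z y k} → adj G x z ≡ true → Walk G z y k → Walk G x y (suc k)

Connected : ∀ {n} → Graph n → Set
Connected G = ∀ x y → ∃ λ k → Walk G x y k

IsDist : ∀ {n} → Graph n → Fin n → Fin n → ℕ → Set
IsDist G x y k = Walk G x y k × (∀ m → Walk G x y m → k ≤ m)

nbhd : ∀ {n} → Graph n → Fin n → Subset n
nbhd G x = tabulate (adj G x)

degree : ∀ {n} → Graph n → Fin n → ℕ
degree G x = ∣ nbhd G x ∣

Adj : ∀ {n} → Graph n → Fin n → Fin n → Set
Adj G x y = adj G x y ≡ true

pathVerts : ∀ {n} → Fin n → List (Fin n) → Fin n → List (Fin n)
pathVerts u I v = u ∷ (I ++ [ v ])

IsPath : ∀ {n} → Graph n → Fin n → List (Fin n) → Fin n → Set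
IsPath G u I v = Linked (Adj G) (pathVerts u I v) × Unique (pathVerts u I v)

Resolving : ∀ {n} → Graph n → Subset n → Set
Resolving G W = ∀ x y → x ≢ y →
  Σ _ λ w → w ∈ W × Σ ℕ λ a → Σ ℕ λ b →
    IsDist G x w a × IsDist G y w b × a ≢ b

module Submission where

-- Let x and y be the neighbours of u on P₁ and P₂, and let w lie outside the interiors.
-- As interior vertices have degree 2, a walk from x to w runs along P₁ until it leaves
-- through u or through v. Leaving through u yields a shorter walk from u; leaving through v
-- takes at least |I₁| > d(u,v) steps, so going to v via a shortest u–v path instead again
-- yields a shorter walk from u. Hence d(y,w) ≤ 1 + d(u,w) ≤ d(x,w), symmetrically
-- d(x,w) ≤ d(y,w), and no vertex of W tells the distinct vertices x and y apart.

open import Defs hiding (sym)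
open import Data.Nat using (ℕ; suc; _+_; _≤_; _<_; s≤s; z≤n; s≤s⁻¹)
open import Data.Nat.Properties
  using (≤-refl; ≤-trans; ≤-antisym; <-≤-trans; n≤1+n; n≮n; m≤n⇒m≤1+n; +-monoˡ-≤; +-monoʳ-≤; +-assoc; +-suc; +-cancelʳ-<)
open import Data.Fin using (Fin)
open import Data.Fin.Properties using (_≟_)
open import Data.Fin.Subset using (Subset; _∈_; _-_; ∣_∣)
open import Data.Fin.Subset.Properties using (x∈p∧x≢y⇒x∈p-y; x∈p⇒∣p-x∣<∣p∣)
open import Data.Vec.Properties using (lookup∘tabulate; lookup⇒[]=)
open import Data.List using (List; []; _∷_; _++_; [_]; _∷ʳ_; _ʳ++_; reverse; length)
open import Data.List.Properties using (length-++; ++-ʳ++; ʳ++-defn)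
open import Data.List.Membership.Propositional using () renaming (_∈_ to _∈ₗ_; _∉_ to _∉ₗ_)
open import Data.List.Membership.Propositional.Properties using (∈-++⁺ˡ; ∈-++⁺ʳ)
open import Data.List.Relation.Unary.Any using (here; there)
open import Data.List.Relation.Unary.All using (All; lookup) renaming (_∷_ to _∷ᴬ_)
open import Data.List.Relation.Unary.AllPairs using () renaming (_∷_ to _∷ᴾ_)
open import Data.List.Relation.Unary.Linked as Linked using (Linked) renaming (_∷_ to _∷ᴸ_)
open import Data.List.Relation.Unary.Unique.Propositional using (Unique)
open import Data.Product using (∃; _×_; _,_; proj₁; proj₂)
open import Data.Sum as Sum using (_⊎_; inj₁; inj₂)
open import Data.Empty using (⊥-elim)
open import Relation.Binary.PropositionalEquality
  using (_≡_; _≢_; refl; sym; trans; cong; cong₂; subst; ≢-sym; module ≡-Reasoning)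
open import Relation.Nullary using (¬_; yes; no; contradiction)

private
  variable
    n d k m : ℕ

module _ {G : Graph n} where

  _++ʷ_ : ∀ {x y z k l} → Walk G x y k → Walk G y z l → Walk G x z (k + l)
  nil       ++ʷ q = q
  cons e p  ++ʷ q = cons e (p ++ʷ q)

Adj-sym : (G : Graph n) {x y : Fin n} → Adj G x y → Adj G y x
Adj-sym G {x} {y} e = trans (Graph.sym G y x) e

ShorterWalk : Graph n → Fin n → Fin n → ℕ → ℕ → Set
ShorterWalk G u w d m = ∃ λ m′ → Walk G u w m′ × d + m′ ≤ m

module _ {G : Graph n} {u w : Fin n} where

  ShorterWalk-suc : ShorterWalk G u w d m → ShorterWalk G u w (suc d) (suc m)
  ShorterWalk-suc (m′ , p , le) = m′ , p , s≤s le

  ShorterWalk-relax : ShorterWalk G u w (suc d) m → ShorterWalk G u w d (suc m)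
  ShorterWalk-relax (m′ , p , le) = m′ , p , m≤n⇒m≤1+n (≤-trans (n≤1+n _) le)

  ShorterWalk-weaken : ∀ {d′} → d′ ≤ d → ShorterWalk G u w d m → ShorterWalk G u w d′ m
  ShorterWalk-weaken d′≤d (m′ , p , le) = m′ , p , ≤-trans (+-monoˡ-≤ m′ d′≤d) le

  ShorterWalk-prepend : ∀ {t} → Walk G t u k → ShorterWalk G u w (d + k) m → ShorterWalk G t w d m
  ShorterWalk-prepend {k = k} {d = d} {m = m} tu (m′ , p , le) =
    k + m′ , tu ++ʷ p , subst (_≤ m) (+-assoc d k m′) le

  ShorterWalk⇒dist≤ : ∀ {a} → IsDist G u w a → ShorterWalk G u w d m → d + a ≤ m
  ShorterWalk⇒dist≤ {d = d} (_ , minimal) (m′ , p , le) = ≤-trans (+-monoʳ-≤ d (minimal m′ p)) le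

distinct₃⇒2<∣p∣ : ∀ {p : Subset n} {a b c} → a ∈ p → b ∈ p → c ∈ p →
                  a ≢ b → a ≢ c → b ≢ c → 2 < ∣ p ∣
distinct₃⇒2<∣p∣ {p = p} {a} {b} {c} a∈p b∈p c∈p a≢b a≢c b≢c =
  <-≤-trans (s≤s 1<∣p-a∣) (x∈p⇒∣p-x∣<∣p∣ a∈p)
  where
  b∈p-a : b ∈ p - a
  b∈p-a = x∈p∧x≢y⇒x∈p-y b∈p (≢-sym a≢b)
  c∈p-a-b : c ∈ p - a - b
  c∈p-a-b = x∈p∧x≢y⇒x∈p-y (x∈p∧x≢y⇒x∈p-y c∈p (≢-sym a≢c)) (≢-sym b≢c)
  1<∣p-a∣ : 1 < ∣ p - a ∣
  1<∣p-a∣ = ≤-trans (s≤s (s≤s z≤n)) (≤-trans (s≤s (x∈p⇒∣p-x∣<∣p∣ c∈p-a-b)) (x∈p⇒∣p-x∣<∣p∣ b∈p-a))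

Adj⇒∈nbhd : (G : Graph n) {x z : Fin n} → Adj G x z → z ∈ nbhd G x
Adj⇒∈nbhd G {x} {z} e = lookup⇒[]= z _ (trans (lookup∘tabulate (adj G x) z) e)

degree≡2⇒neighbour≡⊎≡ : (G : Graph n) {x p q z : Fin n} → degree G x ≡ 2 →
                        Adj G x p → Adj G x q → p ≢ q → Adj G x z → z ≡ p ⊎ z ≡ q
degree≡2⇒neighbour≡⊎≡ G {p = p} {q} {z} deg₂ xp xq p≢q xz with z ≟ p | z ≟ q
... | yes z≡p | _       = inj₁ z≡p
... | no _    | yes z≡q = inj₂ z≡q
... | no z≢p  | no z≢q  =
  ⊥-elim (n≮n 2 (subst (2 <_) deg₂
    (distinct₃⇒2<∣p∣ (Adj⇒∈nbhd G xp) (Adj⇒∈nbhd G xq) (Adj⇒∈nbhd G xz) p≢q (≢-sym z≢p) (≢-sym z≢q))))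

module _ {a} {X : Set a} where

  Linked-middle : ∀ {r} {R : X → X → Set r} (P : List X) {p x q Q} →
                  Linked R (P ++ p ∷ x ∷ q ∷ Q) → R p x × R x q
  Linked-middle []      (Rpx ∷ᴸ Rxq ∷ᴸ _) = Rpx , Rxq
  Linked-middle (_ ∷ P) lk                = Linked-middle P (Linked.tail lk)

  Unique-middle⇒≢ : ∀ (P : List X) {p x q Q} → Unique (P ++ p ∷ x ∷ q ∷ Q) → p ≢ q
  Unique-middle⇒≢ []      ((_ ∷ᴬ p≢q ∷ᴬ _) ∷ᴾ _) = p≢q
  Unique-middle⇒≢ (_ ∷ P) (_ ∷ᴾ un)            = Unique-middle⇒≢ P un

  Unique-∷ʳ⇒∉ : ∀ (I : List X) {v} → Unique (I ∷ʳ v) → v ∉ₗ I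
  Unique-∷ʳ⇒∉ (_ ∷ I) (v∉ ∷ᴾ _)  (here refl) = lookup v∉ (∈-++⁺ʳ I (here refl)) refl
  Unique-∷ʳ⇒∉ (_ ∷ I) (_  ∷ᴾ un) (there v∈I) = Unique-∷ʳ⇒∉ I un v∈I

  ∈-ʳ++⁺ʳ : ∀ (A : List X) {y Z} → y ∈ₗ Z → y ∈ₗ A ʳ++ Z
  ∈-ʳ++⁺ʳ []      y∈Z = y∈Z
  ∈-ʳ++⁺ʳ (_ ∷ A) y∈Z = ∈-ʳ++⁺ʳ A (there y∈Z)

  ʳ++-++-assoc : ∀ (A : List X) {Z W} → (A ʳ++ Z) ++ W ≡ A ʳ++ (Z ++ W)
  ʳ++-++-assoc []      = refl
  ʳ++-++-assoc (_ ∷ A) = ʳ++-++-assoc A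

  firstOf : List X → X → X
  firstOf []      v = v
  firstOf (b ∷ _) _ = b

  ∷ʳ-firstOf : ∀ (B : List X) v → ∃ λ Q → B ∷ʳ v ≡ firstOf B v ∷ Q
  ∷ʳ-firstOf []      v = [] , refl
  ∷ʳ-firstOf (b ∷ B) v = B ∷ʳ v , refl

pathVerts-ʳ++ : ∀ (u v x : Fin n) A B → pathVerts u (A ʳ++ x ∷ B) v ≡ (A ∷ʳ u) ʳ++ x ∷ (B ∷ʳ v)
pathVerts-ʳ++ u v x A B = begin
  u ∷ (A ʳ++ x ∷ B) ++ [ v ]  ≡⟨ cong (u ∷_) (ʳ++-++-assoc A) ⟩
  u ∷ A ʳ++ x ∷ (B ∷ʳ v)      ≡⟨ sym (++-ʳ++ A) ⟩
  (A ∷ʳ u) ʳ++ x ∷ (B ∷ʳ v)   ∎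
  where open ≡-Reasoning

IsPath⇒interior-neighbours : (G : Graph n) {u v x : Fin n} (A B : List (Fin n)) →
  IsPath G u (A ʳ++ x ∷ B) v →
  Adj G (firstOf A u) x × Adj G x (firstOf B v) × firstOf A u ≢ firstOf B v
IsPath⇒interior-neighbours {n} G {u} {v} {x} A B (linked , unique)
  with ∷ʳ-firstOf A u | ∷ʳ-firstOf B v
... | L , A∷ʳu≡ | Q , B∷ʳv≡ =
  proj₁ adjacent , proj₂ adjacent , Unique-middle⇒≢ (reverse L) (subst Unique verts≡ unique)
  where
  open ≡-Reasoning
  p q : Fin n
  p = firstOf A u
  q = firstOf B v
  verts≡ : pathVerts u (A ʳ++ x ∷ B) v ≡ reverse L ++ p ∷ x ∷ q ∷ Q
  verts≡ = begin
    pathVerts u (A ʳ++ x ∷ B) v  ≡⟨ pathVerts-ʳ++ u v x A B ⟩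
    (A ∷ʳ u) ʳ++ x ∷ (B ∷ʳ v)    ≡⟨ cong₂ (λ S T → S ʳ++ x ∷ T) A∷ʳu≡ B∷ʳv≡ ⟩
    L ʳ++ p ∷ x ∷ q ∷ Q          ≡⟨ ʳ++-defn L ⟩
    reverse L ++ p ∷ x ∷ q ∷ Q   ∎
  adjacent : Adj G p x × Adj G x q
  adjacent = Linked-middle (reverse L) (subst (Linked (Adj G)) verts≡ linked)

module InteriorWalk (G : Graph n) {u v w : Fin n} {I : List (Fin n)} (path : IsPath G u I v)
                    (deg₂ : All (λ x → degree G x ≡ 2) I) (w∉I : w ∉ₗ I) where

  -- I ≡ A ʳ++ x ∷ B is a zipper on I: A lists the vertices before x, nearest first.
  interior-neighbour : ∀ A x B → I ≡ A ʳ++ x ∷ B → ∀ {z} → Adj G x z →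
                       z ≡ firstOf A u ⊎ z ≡ firstOf B v
  interior-neighbour A x B I≡ xz =
    let px , xq , p≢q = IsPath⇒interior-neighbours G A B (subst (λ J → IsPath G u J v) I≡ path)
    in  degree≡2⇒neighbour≡⊎≡ G (lookup deg₂ x∈I) (Adj-sym G px) xq p≢q xz
    where
    x∈I : x ∈ₗ I
    x∈I = subst (x ∈ₗ_) (sym I≡) (∈-ʳ++⁺ʳ A (here refl))

  leaves-through-end : ∀ A x B → I ≡ A ʳ++ x ∷ B → Walk G x w m →
    ShorterWalk G u w (suc (length A)) m ⊎ ShorterWalk G v w (suc (length B)) m
  leaves-through-end A x B refl nil = ⊥-elim (w∉I (∈-ʳ++⁺ʳ A (here refl)))
  leaves-through-end A x B refl (cons xz walk) with interior-neighbour A x B refl xz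
  leaves-through-end []      x B refl (cons _ walk) | inj₁ refl = inj₁ (_ , walk , ≤-refl)
  leaves-through-end (a ∷ A) x B refl (cons _ walk) | inj₁ refl =
    Sum.map ShorterWalk-suc ShorterWalk-relax (leaves-through-end A a (x ∷ B) refl walk)
  leaves-through-end A x []      refl (cons _ walk) | inj₂ refl = inj₂ (_ , walk , ≤-refl)
  leaves-through-end A x (b ∷ B) refl (cons _ walk) | inj₂ refl =
    Sum.map ShorterWalk-relax ShorterWalk-suc (leaves-through-end (x ∷ A) b B refl walk)

∉-interior : ∀ {u v w : Fin n} I → Unique (pathVerts u I v) →
             (w ≢ u → w ≢ v → w ∉ₗ pathVerts u I v) → w ∉ₗ I
∉-interior {u = u} {v} {w} I (u∉ ∷ᴾ unique) outside w∈I with w ≟ u | w ≟ v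
... | yes refl | _        = lookup u∉ (∈-++⁺ˡ w∈I) refl
... | no _     | yes refl = Unique-∷ʳ⇒∉ I unique w∈I
... | no w≢u   | no w≢v   = outside w≢u w≢v (there (∈-++⁺ˡ w∈I))

interior-long : ∀ (u v : Fin n) I → k + 2 < length (pathVerts u I v) → k < length I
interior-long {k = k} u v I long = +-cancelʳ-< 2 k (length I) (subst (k + 2 <_) length≡ long)
  where
  length≡ : suc (length (I ∷ʳ _)) ≡ length I + 2
  length≡ = trans (cong suc (length-++ I)) (sym (+-suc (length I) 1))

firstInterior⇒ShorterWalk : (G : Graph n) {u v w x : Fin n} {B : List (Fin n)} →
  IsPath G u (x ∷ B) v → All (λ z → degree G z ≡ 2) (x ∷ B) → w ∉ₗ x ∷ B →
  Walk G u v k → k ≤ length B → Walk G x w m → ShorterWalk G u w 1 m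
firstInterior⇒ShorterWalk G {B = B} path deg₂ w∉ uv k≤∣B∣ walk
  with InteriorWalk.leaves-through-end G path deg₂ w∉ [] _ B refl walk
... | inj₁ viaU = viaU
... | inj₂ viaV = ShorterWalk-prepend uv (ShorterWalk-weaken (s≤s k≤∣B∣) viaV)

neighbour-dist≤firstInterior-dist : (G : Graph n) {u v w x y : Fin n} {B : List (Fin n)} {a b : ℕ} →
  IsPath G u (x ∷ B) v → All (λ z → degree G z ≡ 2) (x ∷ B) → w ∉ₗ x ∷ B →
  Walk G u v k → k ≤ length B → Adj G y u → IsDist G x w a → IsDist G y w b → b ≤ a
neighbour-dist≤firstInterior-dist G path deg₂ w∉ uv k≤∣B∣ yu (xw , _) distY =
  ShorterWalk⇒dist≤ distY
    (ShorterWalk-prepend (cons yu nil) (firstInterior⇒ShorterWalk G path deg₂ w∉ uv k≤∣B∣ xw))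

mainTheorem14 : ∀ {n} (G : Graph n) → Connected G →
    (u v : Fin n) (I₁ I₂ : List (Fin n)) →
    IsPath G u I₁ v → IsPath G u I₂ v →
    (∀ x → x ∈ₗ I₁ → x ∉ₗ I₂) →
    All (λ x → degree G x ≡ 2) I₁ → All (λ x → degree G x ≡ 2) I₂ →
    (k : ℕ) → IsDist G u v k →
    k + 2 < length (pathVerts u I₁ v) → k + 2 < length (pathVerts u I₂ v) →
    (W : Subset n) →
    (∀ x → x ∈ W → x ≢ u → x ≢ v →
      x ∉ₗ pathVerts u I₁ v × x ∉ₗ pathVerts u I₂ v) →
    ¬ Resolving G W
mainTheorem14 G _ u v [] I₂ _ _ _ _ _ k _ long₁ _ _ _ _ = contradiction (interior-long u v [] long₁) λ ()
mainTheorem14 G _ u v I₁ [] _ _ _ _ _ k _ _ long₂ _ _ _ = contradiction (interior-long u v [] long₂) λ ()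
mainTheorem14 G _ u v (x ∷ B₁) (y ∷ B₂) path₁ path₂ disjoint deg₁ deg₂ k (uv , _) long₁ long₂ _
              outside resolving
  with resolving x y (λ x≡y → disjoint x (here refl) (here x≡y))
... | w , w∈W , a , b , distX , distY , a≢b =
  a≢b (≤-antisym
    (neighbour-dist≤firstInterior-dist G path₂ deg₂ w∉I₂ uv k≤∣B₂∣ xu distY distX)
    (neighbour-dist≤firstInterior-dist G path₁ deg₁ w∉I₁ uv k≤∣B₁∣ yu distX distY))
  where
  k≤∣B₁∣ : k ≤ length B₁
  k≤∣B₁∣ = s≤s⁻¹ (interior-long u v (x ∷ B₁) long₁)
  k≤∣B₂∣ : k ≤ length B₂
  k≤∣B₂∣ = s≤s⁻¹ (interior-long u v (y ∷ B₂) long₂)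
  xu : Adj G x u
  xu = Adj-sym G (Linked.head (proj₁ path₁))
  yu : Adj G y u
  yu = Adj-sym G (Linked.head (proj₁ path₂))
  w∉I₁ : w ∉ₗ x ∷ B₁
  w∉I₁ = ∉-interior (x ∷ B₁) (proj₂ path₁) λ w≢u w≢v → proj₁ (outside w w∈W w≢u w≢v)
  w∉I₂ : w ∉ₗ y ∷ B₂
  w∉I₂ = ∉-interior (y ∷ B₂) (proj₂ path₂) λ w≢u w≢v → proj₂ (outside w w∈W w≢u w≢v)
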